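{- Let $k$ be a positive integer. For $n\ge k$ let $R_{n,k}=\mathbb{Z}[x_1,\dots,x_n]/\langle x_1^k,\dots,x_n^k,e_n,\dots,e_{n-k+1}\rangle$, and consider the inverse system $R_{n+1,k}\twoheadrightarrow R_{n,k}$ ($n\ge k$) induced by $(x_1,\dots,x_n,x_{n+1})\mapsto(x_1,\dots,x_n,0)$, with inverse limit $R_{\bullet,k}$. Let $P_{\bullet,k}=\mathbb{Z}[[x_1,x_2,\dots]]/\langle x_1^k,x_2^k,\dots\rangle$. Then the maps $P_{\bullet,k}\to R_{n,k}$ given by setting $x_i=0$ for $i>n$ make $P_{\bullet,k}$ an inverse limit of this system; in particular there is a canonical isomorphism $R_{\bullet,k}\cong P_{\bullet,k}$.
   Context: $e_d$ denotes the $d$-th elementary symmetric polynomial in $x_1,\dots,x_n$. -}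

module Defs where

open import Data.Bool using (Bool; true; false; if_then_else_)
open import Data.Nat as ℕ using (ℕ; zero; suc; _∸_; _≡ᵇ_; _<_)
open import Data.Integer as ℤ using (ℤ; 0ℤ; 1ℤ)
open import Data.Fin as Fin using (Fin; toℕ)
open import Data.Vec as Vec using (Vec; []; _∷_; tabulate; toList; init; last; replicate; zipWith)
import Data.Vec.Properties as VecP
open import Data.List as List using (List; []; _∷_; _++_; map; concat; concatMap; upTo; allFin; filterᵇ; foldr)
open import Data.List.Relation.Unary.All using (All)
open import Data.Product using (Σ; _×_; _,_; proj₁; proj₂)
open import Relation.Binary.PropositionalEquality using (_≡_)
open import Relation.Nullary using (does)

-- A polynomial is a formal finite sum of terms c·x^v (coefficient c,
-- exponent vector v, whose i-th entry is the exponent of x_{i+1}).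

Mono : ℕ → Set
Mono n = Vec ℕ n

Poly : ℕ → Set
Poly n = List (ℤ × Mono n)

coeff : ∀ {n} → Poly n → Mono n → ℤ
coeff p v = foldr ℤ._+_ 0ℤ
  (map proj₁ (filterᵇ (λ t → does (VecP.≡-dec ℕ._≟_ (proj₂ t) v)) p))

_≈P_ : ∀ {n} → Poly n → Poly n → Set
p ≈P q = ∀ v → coeff p v ≡ coeff q v

_+P_ : ∀ {n} → Poly n → Poly n → Poly n
p +P q = p ++ q

-P_ : ∀ {n} → Poly n → Poly n
-P p = map (λ t → (ℤ.- proj₁ t , proj₂ t)) p

_*P_ : ∀ {n} → Poly n → Poly n → Poly n
p *P q = concatMap (λ s → map (λ t → (proj₁ s ℤ.* proj₁ t , zipWith ℕ._+_ (proj₂ s) (proj₂ t))) q) p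

1P : ∀ {n} → Poly n
1P {n} = (1ℤ , replicate n 0) ∷ []

ΣP : ∀ {n} → List (Poly n) → Poly n
ΣP = concat

xpow : ∀ {n} → Fin n → ℕ → Poly n
xpow {n} i k = (1ℤ , tabulate (λ j → if does (i Fin.≟ j) then k else 0)) ∷ []

boxVecs : ℕ → (n : ℕ) → List (Vec ℕ n)
boxVecs k zero = [] ∷ []
boxVecs k (suc n) = concatMap (λ a → map (a ∷_) (boxVecs k n)) (upTo k)

vsum : ∀ {n} → Vec ℕ n → ℕ
vsum = Vec.foldr _ ℕ._+_ 0

esym : (n d : ℕ) → Poly n
esym n d = map (λ v → (1ℤ , v)) (filterᵇ (λ v → vsum v ≡ᵇ d) (boxVecs 2 n))

InIdeal : (k n : ℕ) → Poly n → Set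
InIdeal k n f =
  Σ (Fin n → Poly n) λ g → Σ (Fin k → Poly n) λ h →
    f ≈P (ΣP (map (λ i → g i *P xpow i k) (allFin n))
          +P ΣP (map (λ j → h j *P esym n (n ∸ toℕ j)) (allFin k)))

EqR : (k n : ℕ) → Poly n → Poly n → Set
EqR k n p q = InIdeal k n (p +P (-P q))

proj : ∀ {n} → Poly (suc n) → Poly n
proj p = map (λ t → (proj₁ t , init (proj₂ t))) (filterᵇ (λ t → last (proj₂ t) ≡ᵇ 0) p)

-- A monomial is a finitely supported exponent sequence, represented by
-- the list of exponents of x₁,x₂,… with trailing zeros removed (strip).
-- A series is a function f : List ℕ → ℤ; the coefficient of the monomial
-- with exponent list m is f (strip m) (values at non-normal lists are ignored).

cons0 : ℕ → List ℕ → List ℕ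
cons0 zero [] = []
cons0 a m = a ∷ m

strip : List ℕ → List ℕ
strip [] = []
strip (a ∷ m) = cons0 a (strip m)

Series : Set
Series = List ℕ → ℤ

scoeff : Series → List ℕ → ℤ
scoeff f m = f (strip m)

splits : List ℕ → List (List ℕ × List ℕ)
splits [] = ([] , []) ∷ []
splits (a ∷ m) = concatMap (λ i → map (λ pq → (i ∷ proj₁ pq , (a ∸ i) ∷ proj₂ pq)) (splits m)) (upTo (suc a))

_+S_ : Series → Series → Series
(f +S g) m = scoeff f m ℤ.+ scoeff g m

_*S_ : Series → Series → Series
(f *S g) m = foldr ℤ._+_ 0ℤ (map (λ pq → scoeff f (proj₁ pq) ℤ.* scoeff g (proj₂ pq)) (splits (strip m)))

oneS₀ : List ℕ → ℤ
oneS₀ [] = 1ℤ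
oneS₀ (_ ∷ _) = 0ℤ

1S : Series
1S m = oneS₀ (strip m)

-- Equality in P_{•,k} = ℤ[[x₁,x₂,…]] / ⟨x₁^k, x₂^k, …⟩ : the ideal is the
-- (closed) ideal of series all of whose monomials have some exponent ≥ k,
-- so two series are equal in P iff their coefficients agree on every
-- monomial with all exponents < k.
_≈[P_]_ : Series → ℕ → Series → Set
f ≈[P k ] g = ∀ m → All (_< k) m → scoeff f m ≡ scoeff g m

-- the map P_{•,k} → R_{n,k}: set x_i = 0 for i > n (and reduce mod xᵢ^k)
trunc : (k n : ℕ) → Series → Poly n
trunc k n f = map (λ v → (scoeff f (toList v) , v)) (boxVecs k n)

-- Call an exponent w a box exponent if all w_i < k. Every polynomial is congruent modulo
-- x_1^k,…,x_n^k to its box part, while an element of I_{n,k} has no box monomial of degree ≤ n - k: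
-- multiples of x_i^k contain no box monomial, and e_{n-j} (j < k) lives in degree > n - k. Hence the
-- box coefficients of degree ≤ n - k are invariants of R_{n,k}, and every box monomial has such low
-- degree once n is large. Setting x_{n+1} = 0 maps I_{n+1,k} into I_{n,k} and keeps these invariants,
-- so a compatible family (a_n) has eventually constant box coefficients; they define the limit series.

module Submission where

open import Defs
open import Data.Nat using (ℕ; suc; _≤_)
open import Data.Product using (Σ; _×_)
open import Data.Bool using (Bool; true; false; if_then_else_; _∧_; not; T)
import Data.Bool.Properties as BoolP
open import Data.Nat as ℕ using (zero; _∸_; _≡ᵇ_; _<ᵇ_; _≤ᵇ_; _<_; z≤n; s≤s)
import Data.Nat.Properties as ℕP
import Data.Nat.ListAction as ListAction
open import Data.Integer as ℤ using (ℤ; 0ℤ; 1ℤ; _+_; _*_; -_)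
import Data.Integer.Properties as ℤP
open import Data.Integer.Tactic.RingSolver using (solve-∀)
open import Data.Fin as Fin using (Fin; toℕ; inject₁; fromℕ)
import Data.Fin.Properties as FinP
open import Data.Vec as Vec using (Vec; []; _∷_; tabulate; toList; init; last; replicate; zipWith; _∷ʳ_; initLast)
import Data.Vec.Properties as VecP
open import Data.List as List using (List; []; _∷_; _++_; map; concat; concatMap; upTo; allFin; filterᵇ; foldr; length; applyUpTo)
open import Data.List.Relation.Unary.All using (All; []; _∷_)
open import Data.Product using (_,_; proj₁; proj₂)
open import Data.Empty using (⊥-elim)
open import Function using (_∘_; case_of_; Equivalence)
open import Relation.Binary.PropositionalEquality
open import Relation.Nullary using (does; yes; no)
open import Algebra.Properties.CommutativeSemigroup ℤP.+-commutativeSemigroup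
  using () renaming (interchange to +-interchange)
open import Algebra.Properties.Semiring.Sum ℤP.+-*-semiring
  using (sum; sum-syntax; sum-cong-≗; ∑-distrib-+; sum-init-last; sum-replicate-zero)


T⇒true : ∀ {b} → T b → b ≡ true
T⇒true = Equivalence.to BoolP.T-≡

true⇒T : ∀ {b} → b ≡ true → T b
true⇒T = Equivalence.from BoolP.T-≡

∑ˡ : {A : Set} → List A → (A → ℤ) → ℤ
∑ˡ xs F = foldr _+_ 0ℤ (map F xs)

module _ {A : Set} where

  ∑ˡ-++ : (xs ys : List A) (F : A → ℤ) → ∑ˡ (xs ++ ys) F ≡ ∑ˡ xs F + ∑ˡ ys F
  ∑ˡ-++ [] ys F = sym (ℤP.+-identityˡ _)
  ∑ˡ-++ (x ∷ xs) ys F = trans (cong (F x +_) (∑ˡ-++ xs ys F)) (sym (ℤP.+-assoc (F x) _ _))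

  ∑ˡ-cong : (xs : List A) {F G : A → ℤ} → (∀ x → F x ≡ G x) → ∑ˡ xs F ≡ ∑ˡ xs G
  ∑ˡ-cong [] e = refl
  ∑ˡ-cong (x ∷ xs) e = cong₂ _+_ (e x) (∑ˡ-cong xs e)

  ∑ˡ-zero : (xs : List A) {F : A → ℤ} → (∀ x → F x ≡ 0ℤ) → ∑ˡ xs F ≡ 0ℤ
  ∑ˡ-zero [] e = refl
  ∑ˡ-zero (x ∷ xs) e = cong₂ _+_ (e x) (∑ˡ-zero xs e)

  *-distribˡ-∑ˡ : (xs : List A) (c : ℤ) (F : A → ℤ) → ∑ˡ xs (λ x → c * F x) ≡ c * ∑ˡ xs F
  *-distribˡ-∑ˡ [] c F = sym (ℤP.*-zeroʳ c)
  *-distribˡ-∑ˡ (x ∷ xs) c F =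
    trans (cong ((c * F x) +_) (*-distribˡ-∑ˡ xs c F)) (sym (ℤP.*-distribˡ-+ c (F x) _))

  neg-distrib-∑ˡ : (xs : List A) (F : A → ℤ) → ∑ˡ xs (λ x → - F x) ≡ - ∑ˡ xs F
  neg-distrib-∑ˡ [] F = refl
  neg-distrib-∑ˡ (x ∷ xs) F =
    trans (cong ((- F x) +_) (neg-distrib-∑ˡ xs F)) (sym (ℤP.neg-distrib-+ (F x) _))

  ∑ˡ-filterᵇ : (P : A → Bool) (xs : List A) (F : A → ℤ) →
               ∑ˡ (filterᵇ P xs) F ≡ ∑ˡ xs (λ x → if P x then F x else 0ℤ)
  ∑ˡ-filterᵇ P [] F = refl
  ∑ˡ-filterᵇ P (x ∷ xs) F with P x
  ... | true = cong (F x +_) (∑ˡ-filterᵇ P xs F)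
  ... | false = trans (∑ˡ-filterᵇ P xs F) (sym (ℤP.+-identityˡ _))

  ∑ˡ-if : (xs : List A) (b : Bool) (F : A → ℤ) →
          ∑ˡ xs (λ x → if b then F x else 0ℤ) ≡ (if b then ∑ˡ xs F else 0ℤ)
  ∑ˡ-if xs true F = refl
  ∑ˡ-if xs false F = ∑ˡ-zero xs (λ _ → refl)

module _ {A B : Set} where

  ∑ˡ-map : (g : A → B) (xs : List A) (F : B → ℤ) → ∑ˡ (map g xs) F ≡ ∑ˡ xs (F ∘ g)
  ∑ˡ-map g [] F = refl
  ∑ˡ-map g (x ∷ xs) F = cong (F (g x) +_) (∑ˡ-map g xs F)

  ∑ˡ-concatMap : (g : A → List B) (xs : List A) (F : B → ℤ) →
                 ∑ˡ (concatMap g xs) F ≡ ∑ˡ xs (λ x → ∑ˡ (g x) F)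
  ∑ˡ-concatMap g [] F = refl
  ∑ˡ-concatMap g (x ∷ xs) F =
    trans (∑ˡ-++ (g x) (concatMap g xs) F) (cong (∑ˡ (g x) F +_) (∑ˡ-concatMap g xs F))

∑ˡ-concat : {A : Set} (xss : List (List A)) (F : A → ℤ) → ∑ˡ (concat xss) F ≡ ∑ˡ xss (λ xs → ∑ˡ xs F)
∑ˡ-concat [] F = refl
∑ˡ-concat (xs ∷ xss) F = trans (∑ˡ-++ xs (concat xss) F) (cong (∑ˡ xs F +_) (∑ˡ-concat xss F))

∑ˡ-tabulate : {A : Set} (n : ℕ) (f : Fin n → A) (F : A → ℤ) → ∑ˡ (List.tabulate f) F ≡ ∑[ i < n ] F (f i)
∑ˡ-tabulate zero f F = refl
∑ˡ-tabulate (suc n) f F = cong (F (f Fin.zero) +_) (∑ˡ-tabulate n (f ∘ Fin.suc) F)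

∑ˡ-upTo : ∀ k (F : ℕ → ℤ) → ∑ˡ (upTo k) F ≡ ∑[ i < k ] F (toℕ i)
∑ˡ-upTo k F = go k (λ i → i)
  where
  go : ∀ k (f : ℕ → ℕ) → ∑ˡ (applyUpTo f k) F ≡ ∑[ i < k ] F (f (toℕ i))
  go zero f = refl
  go (suc k) f = cong (F (f 0) +_) (go k (f ∘ suc))

∑-zero : ∀ n {F : Fin n → ℤ} → (∀ i → F i ≡ 0ℤ) → ∑[ i < n ] F i ≡ 0ℤ
∑-zero n e = trans (sum-cong-≗ e) (sum-replicate-zero n)

∑-single : ∀ n (F : Fin n → ℤ) (i : Fin n) → (∀ j → j ≢ i → F j ≡ 0ℤ) → ∑[ j < n ] F j ≡ F i
∑-single (suc n) F Fin.zero e =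
  trans (cong (F Fin.zero +_) (∑-zero n (λ j → e (Fin.suc j) λ ()))) (ℤP.+-identityʳ _)
∑-single (suc n) F (Fin.suc i) e =
  trans (cong₂ _+_ (e Fin.zero λ ()) (∑-single n (F ∘ Fin.suc) i (λ j j≢i → e (Fin.suc j) (j≢i ∘ FinP.suc-injective))))
        (ℤP.+-identityˡ _)

_+ᵥ_ _∸ᵥ_ : ∀ {n} → Vec ℕ n → Vec ℕ n → Vec ℕ n
_+ᵥ_ = zipWith ℕ._+_
_∸ᵥ_ = zipWith _∸_

_≤ᵥᵇ_ : ∀ {n} → Vec ℕ n → Vec ℕ n → Bool
[] ≤ᵥᵇ [] = true
(x ∷ xs) ≤ᵥᵇ (y ∷ ys) = (x ≤ᵇ y) ∧ (xs ≤ᵥᵇ ys)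

inBoxᵇ : ∀ {n} → ℕ → Vec ℕ n → Bool
inBoxᵇ k [] = true
inBoxᵇ k (x ∷ v) = (x <ᵇ k) ∧ inBoxᵇ k v

inBoxᵇ-head : ∀ {n} k x (v : Vec ℕ n) → inBoxᵇ k (x ∷ v) ≡ true → x < k
inBoxᵇ-head k x v x∷v∈box = ℕP.<ᵇ⇒< x k (true⇒T (BoolP.∧-conicalˡ _ _ x∷v∈box))

inBoxᵇ-tail : ∀ {n} k x (v : Vec ℕ n) → inBoxᵇ k (x ∷ v) ≡ true → inBoxᵇ k v ≡ true
inBoxᵇ-tail k x v = BoolP.∧-conicalʳ (x <ᵇ k) (inBoxᵇ k v)

≤ᵥᵇ-+ᵥ : ∀ {n} (u t : Vec ℕ n) → u ≤ᵥᵇ (u +ᵥ t) ≡ true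
≤ᵥᵇ-+ᵥ [] [] = refl
≤ᵥᵇ-+ᵥ (x ∷ u) (y ∷ t) rewrite ≤ᵥᵇ-+ᵥ u t | T⇒true (ℕP.≤⇒≤ᵇ (ℕP.m≤m+n x y)) = refl

+ᵥ-∸ᵥ : ∀ {n} (u t : Vec ℕ n) → (u +ᵥ t) ∸ᵥ u ≡ t
+ᵥ-∸ᵥ [] [] = refl
+ᵥ-∸ᵥ (x ∷ u) (y ∷ t) = cong₂ _∷_ (ℕP.m+n∸m≡n x y) (+ᵥ-∸ᵥ u t)

∸ᵥ-+ᵥ : ∀ {n} (u w : Vec ℕ n) → u ≤ᵥᵇ w ≡ true → u +ᵥ (w ∸ᵥ u) ≡ w
∸ᵥ-+ᵥ [] [] _ = refl
∸ᵥ-+ᵥ (x ∷ u) (y ∷ w) x≤y∧u≤w = cong₂ _∷_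
  (ℕP.m+[n∸m]≡n (ℕP.≤ᵇ⇒≤ x y (true⇒T (BoolP.∧-conicalˡ _ _ x≤y∧u≤w))))
  (∸ᵥ-+ᵥ u w (BoolP.∧-conicalʳ _ _ x≤y∧u≤w))

δ : ∀ {n} → Vec ℕ n → Vec ℕ n → ℤ → ℤ
δ u v c = if does (VecP.≡-dec ℕ._≟_ u v) then c else 0ℤ

δ-≡ : ∀ {n} {u v : Vec ℕ n} {c} → u ≡ v → δ u v c ≡ c
δ-≡ {u = u} {v} u≡v with VecP.≡-dec ℕ._≟_ u v
... | yes _ = refl
... | no u≢v = ⊥-elim (u≢v u≡v)

δ-≢ : ∀ {n} {u v : Vec ℕ n} {c} → u ≢ v → δ u v c ≡ 0ℤ
δ-≢ {u = u} {v} u≢v with VecP.≡-dec ℕ._≟_ u v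
... | yes u≡v = ⊥-elim (u≢v u≡v)
... | no _ = refl

δ-map : ∀ {n} (u v : Vec ℕ n) (f : ℤ → ℤ) → f 0ℤ ≡ 0ℤ → ∀ c → δ u v (f c) ≡ f (δ u v c)
δ-map u v f f0 c with VecP.≡-dec ℕ._≟_ u v
... | yes _ = refl
... | no _ = sym f0

δ-+ᵥ : ∀ {n} (u t w : Vec ℕ n) c → δ (u +ᵥ t) w c ≡ (if u ≤ᵥᵇ w then δ t (w ∸ᵥ u) c else 0ℤ)
δ-+ᵥ u t w c with VecP.≡-dec ℕ._≟_ (u +ᵥ t) w
... | yes refl rewrite ≤ᵥᵇ-+ᵥ u t | +ᵥ-∸ᵥ u t = sym (δ-≡ {u = t} refl)
... | no u+t≢w with u ≤ᵥᵇ w in u≤w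
...   | true = sym (δ-≢ λ t≡w∸u → u+t≢w (trans (cong (u +ᵥ_) t≡w∸u) (∸ᵥ-+ᵥ u w u≤w)))
...   | false = refl

δ-∷ʳ : ∀ {n} (u v : Vec ℕ n) x c → δ (u ∷ʳ x) (v ∷ʳ x) c ≡ δ u v c
δ-∷ʳ u v x c with VecP.≡-dec ℕ._≟_ u v
... | yes refl = δ-≡ {u = u ∷ʳ x} refl
... | no u≢v = δ-≢ {u = u ∷ʳ x} {v ∷ʳ x} (u≢v ∘ VecP.∷ʳ-injectiveˡ u v)

coeff-∑ˡ : ∀ {n} (p : Poly n) v → coeff p v ≡ ∑ˡ p (λ t → δ (proj₂ t) v (proj₁ t))
coeff-∑ˡ p v = ∑ˡ-filterᵇ _ p proj₁

coeff-+P : ∀ {n} (p q : Poly n) w → coeff (p +P q) w ≡ coeff p w + coeff q w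
coeff-+P p q w rewrite coeff-∑ˡ (p +P q) w | coeff-∑ˡ p w | coeff-∑ˡ q w = ∑ˡ-++ p q _

coeff--P : ∀ {n} (p : Poly n) w → coeff (-P p) w ≡ - coeff p w
coeff--P p w rewrite coeff-∑ˡ (-P p) w | coeff-∑ˡ p w =
  trans (∑ˡ-map _ p _) (trans (∑ˡ-cong p (λ t → δ-map (proj₂ t) w -_ refl (proj₁ t))) (neg-distrib-∑ˡ p _))

coeff-ΣP : ∀ {n} (ps : List (Poly n)) w → coeff (ΣP ps) w ≡ ∑ˡ ps (λ p → coeff p w)
coeff-ΣP ps w = trans (coeff-∑ˡ (ΣP ps) w) (trans (∑ˡ-concat ps _) (∑ˡ-cong ps (λ p → sym (coeff-∑ˡ p w))))

coeff-*P : ∀ {n} (p q : Poly n) w →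
           coeff (p *P q) w ≡ ∑ˡ p (λ s → proj₁ s * (if proj₂ s ≤ᵥᵇ w then coeff q (w ∸ᵥ proj₂ s) else 0ℤ))
coeff-*P p q w = begin
  coeff (p *P q) w                                  ≡⟨ coeff-∑ˡ (p *P q) w ⟩
  ∑ˡ (p *P q) (λ t → δ (proj₂ t) w (proj₁ t))      ≡⟨ ∑ˡ-concatMap _ p _ ⟩
  _                                                 ≡⟨ ∑ˡ-cong p (λ (c , u) → term c u) ⟩
  _                                                 ∎
  where
  open ≡-Reasoning
  term : ∀ c u → ∑ˡ (map (λ t → (c * proj₁ t , u +ᵥ proj₂ t)) q) (λ t → δ (proj₂ t) w (proj₁ t))
               ≡ c * (if u ≤ᵥᵇ w then coeff q (w ∸ᵥ u) else 0ℤ)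
  term c u = begin
    _                                                                    ≡⟨ ∑ˡ-map _ q _ ⟩
    ∑ˡ q (λ t → δ (u +ᵥ proj₂ t) w (c * proj₁ t))                        ≡⟨ ∑ˡ-cong q (λ t → δ-+ᵥ u (proj₂ t) w _) ⟩
    ∑ˡ q (λ t → if u ≤ᵥᵇ w then δ (proj₂ t) (w ∸ᵥ u) (c * proj₁ t) else 0ℤ) ≡⟨ ∑ˡ-if q (u ≤ᵥᵇ w) _ ⟩
    (if u ≤ᵥᵇ w then ∑ˡ q (λ t → δ (proj₂ t) (w ∸ᵥ u) (c * proj₁ t)) else 0ℤ)
      ≡⟨ BoolP.if-cong-then (u ≤ᵥᵇ w) (scale (w ∸ᵥ u)) ⟩
    (if u ≤ᵥᵇ w then c * coeff q (w ∸ᵥ u) else 0ℤ)                      ≡⟨ if-* (u ≤ᵥᵇ w) ⟩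
    c * (if u ≤ᵥᵇ w then coeff q (w ∸ᵥ u) else 0ℤ)                       ∎
    where
    scale : ∀ v → ∑ˡ q (λ t → δ (proj₂ t) v (c * proj₁ t)) ≡ c * coeff q v
    scale v = trans (∑ˡ-cong q (λ t → δ-map (proj₂ t) v (c *_) (ℤP.*-zeroʳ c) (proj₁ t)))
                    (trans (*-distribˡ-∑ˡ q c _) (cong (c *_) (sym (coeff-∑ˡ q v))))
    if-* : ∀ b {x} → (if b then c * x else 0ℤ) ≡ c * (if b then x else 0ℤ)
    if-* true = refl
    if-* false = sym (ℤP.*-zeroʳ c)

*P-congʳ : ∀ {n} (p : Poly n) {q q' : Poly n} → q ≈P q' → (p *P q) ≈P (p *P q')
*P-congʳ p {q} {q'} q≈q' w = trans (coeff-*P p q w)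
  (trans (∑ˡ-cong p (λ s → cong (λ z → proj₁ s * (if proj₂ s ≤ᵥᵇ w then z else 0ℤ)) (q≈q' _)))
         (sym (coeff-*P p q' w)))

*P-distribʳ-+P : ∀ {n} (p p' q : Poly n) w → coeff ((p +P p') *P q) w ≡ coeff (p *P q) w + coeff (p' *P q) w
*P-distribʳ-+P p p' q w rewrite coeff-*P (p +P p') q w | coeff-*P p q w | coeff-*P p' q w = ∑ˡ-++ p p' _

*P-zeroʳ : ∀ {n} (p : Poly n) → (p *P []) ≈P []
*P-zeroʳ p w = trans (coeff-*P p [] w)
  (∑ˡ-zero p (λ s → trans (cong (proj₁ s *_) (BoolP.if-eta (proj₂ s ≤ᵥᵇ w))) (ℤP.*-zeroʳ (proj₁ s))))

coeff-1P : ∀ {n} w → coeff (1P {n}) w ≡ δ (replicate n 0) w 1ℤ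
coeff-1P {n} w = trans (coeff-∑ˡ (1P {n}) w) (ℤP.+-identityʳ _)

unitV : ∀ {n} → Fin n → ℕ → Vec ℕ n
unitV i k = tabulate (λ j → if does (i Fin.≟ j) then k else 0)

coeff-xpow : ∀ {n} (i : Fin n) k w → coeff (xpow i k) w ≡ δ (unitV i k) w 1ℤ
coeff-xpow i k w = trans (coeff-∑ˡ (xpow i k) w) (ℤP.+-identityʳ _)

∑ˡ-boxVecs-δ : ∀ k n (c : Vec ℕ n → ℤ) (w : Vec ℕ n) →
               ∑ˡ (boxVecs k n) (λ v → δ v w (c v)) ≡ (if inBoxᵇ k w then c w else 0ℤ)
∑ˡ-boxVecs-δ k zero c [] = ℤP.+-identityʳ _
∑ˡ-boxVecs-δ k (suc n) c (b ∷ w) = begin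
  ∑ˡ (boxVecs k (suc n)) (λ v → δ v (b ∷ w) (c v))
    ≡⟨ trans (∑ˡ-concatMap _ (upTo k) _) (∑ˡ-upTo k _) ⟩
  ∑[ a < k ] ∑ˡ (map (toℕ a ∷_) (boxVecs k n)) (λ v → δ v (b ∷ w) (c v))
    ≡⟨ sum-cong-≗ {k} (λ a → trans (∑ˡ-map _ (boxVecs k n) _) (∑ˡ-cong (boxVecs k n) (λ v → δ-∷ (toℕ a) v))) ⟩
  ∑[ a < k ] ∑ˡ (boxVecs k n) (λ v → if toℕ a ≡ᵇ b then δ v w (c (toℕ a ∷ v)) else 0ℤ)
    ≡⟨ sum-cong-≗ {k} (λ a → trans (∑ˡ-if (boxVecs k n) (toℕ a ≡ᵇ b) _)
                                (BoolP.if-cong-then (toℕ a ≡ᵇ b) (∑ˡ-boxVecs-δ k n (c ∘ (toℕ a ∷_)) w))) ⟩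
  ∑[ a < k ] (if toℕ a ≡ᵇ b then (if inBoxᵇ k w then c (toℕ a ∷ w) else 0ℤ) else 0ℤ)
    ≡⟨ ∑-≡ᵇ k b (λ a → if inBoxᵇ k w then c (a ∷ w) else 0ℤ) ⟩
  (if b <ᵇ k then (if inBoxᵇ k w then c (b ∷ w) else 0ℤ) else 0ℤ)
    ≡⟨ sym (BoolP.if-∧ (b <ᵇ k)) ⟩
  (if inBoxᵇ k (b ∷ w) then c (b ∷ w) else 0ℤ) ∎
  where
  open ≡-Reasoning
  δ-∷ : ∀ a v → δ (a ∷ v) (b ∷ w) (c (a ∷ v)) ≡ (if a ≡ᵇ b then δ v w (c (a ∷ v)) else 0ℤ)
  δ-∷ a v with a ≡ᵇ b
  ... | true = refl
  ... | false = refl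
  ∑-≡ᵇ : ∀ k b (X : ℕ → ℤ) → ∑[ a < k ] (if toℕ a ≡ᵇ b then X (toℕ a) else 0ℤ) ≡ (if b <ᵇ k then X b else 0ℤ)
  ∑-≡ᵇ zero b X = refl
  ∑-≡ᵇ (suc k) zero X = trans (cong (X 0 +_) (∑-zero k (λ _ → refl))) (ℤP.+-identityʳ _)
  ∑-≡ᵇ (suc k) (suc b) X = trans (ℤP.+-identityˡ _) (∑-≡ᵇ k b (X ∘ suc))

coeff-trunc : ∀ k n f (w : Vec ℕ n) → coeff (trunc k n f) w ≡ (if inBoxᵇ k w then scoeff f (toList w) else 0ℤ)
coeff-trunc k n f w =
  trans (coeff-∑ˡ (trunc k n f) w) (trans (∑ˡ-map _ (boxVecs k n) _) (∑ˡ-boxVecs-δ k n (scoeff f ∘ toList) w))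

coeff-esym : ∀ n d w → coeff (esym n d) w ≡ (if inBoxᵇ 2 w then (if vsum w ≡ᵇ d then 1ℤ else 0ℤ) else 0ℤ)
coeff-esym n d w = begin
  coeff (esym n d) w                                                    ≡⟨ coeff-∑ˡ (esym n d) w ⟩
  _                                                                     ≡⟨ ∑ˡ-map _ (filterᵇ _ (boxVecs 2 n)) _ ⟩
  ∑ˡ (filterᵇ (λ v → vsum v ≡ᵇ d) (boxVecs 2 n)) (λ v → δ v w 1ℤ)        ≡⟨ ∑ˡ-filterᵇ _ (boxVecs 2 n) _ ⟩
  ∑ˡ (boxVecs 2 n) (λ v → if vsum v ≡ᵇ d then δ v w 1ℤ else 0ℤ)           ≡⟨ ∑ˡ-cong (boxVecs 2 n) (λ v → if-δ (vsum v ≡ᵇ d) v) ⟩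
  ∑ˡ (boxVecs 2 n) (λ v → δ v w (if vsum v ≡ᵇ d then 1ℤ else 0ℤ))         ≡⟨ ∑ˡ-boxVecs-δ 2 n _ w ⟩
  _                                                                     ∎
  where
  open ≡-Reasoning
  if-δ : ∀ b v → (if b then δ v w 1ℤ else 0ℤ) ≡ δ v w (if b then 1ℤ else 0ℤ)
  if-δ true v = refl
  if-δ false v = sym (δ-map v w (λ _ → 0ℤ) refl 1ℤ)

-- The ideal I_{n,k}

combination : ∀ k n → (Fin n → Poly n) → (Fin k → Poly n) → Poly n
combination k n g h = ΣP (map (λ i → g i *P xpow i k) (allFin n))
                   +P ΣP (map (λ j → h j *P esym n (n ∸ toℕ j)) (allFin k))

xpowPart : ∀ k n → (Fin n → Poly n) → Vec ℕ n → ℤ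
xpowPart k n g w = ∑[ i < n ] coeff (g i *P xpow i k) w

esymPart : ∀ k n → (Fin k → Poly n) → Vec ℕ n → ℤ
esymPart k n h w = ∑[ j < k ] coeff (h j *P esym n (n ∸ toℕ j)) w

combinationCoeff : ∀ k n → (Fin n → Poly n) → (Fin k → Poly n) → Vec ℕ n → ℤ
combinationCoeff k n g h w = xpowPart k n g w + esymPart k n h w

coeff-combination : ∀ k n g h w → coeff (combination k n g h) w ≡ combinationCoeff k n g h w
coeff-combination k n g h w =
  trans (coeff-+P (ΣP (map G (allFin n))) (ΣP (map H (allFin k))) w) (cong₂ _+_ (sum-of n G) (sum-of k H))
  where
  G = λ i → g i *P xpow i k
  H = λ j → h j *P esym n (n ∸ toℕ j)
  sum-of : ∀ m (P : Fin m → Poly n) → coeff (ΣP (map P (allFin m))) w ≡ ∑[ i < m ] coeff (P i) w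
  sum-of m P = trans (coeff-ΣP (map P (allFin m)) w) (trans (∑ˡ-map P (allFin m) _) (∑ˡ-tabulate m (λ i → i) _))

InIdeal-intro : ∀ {k n p} g h → (∀ w → coeff p w ≡ combinationCoeff k n g h w) → InIdeal k n p
InIdeal-intro {k} {n} g h e = g , h , λ w → trans (e w) (sym (coeff-combination k n g h w))

InIdeal-coeff : ∀ {k n p} → (I : InIdeal k n p) → ∀ w → coeff p w ≡ combinationCoeff k n (proj₁ I) (proj₁ (proj₂ I)) w
InIdeal-coeff {k} {n} (g , h , e) w = trans (e w) (coeff-combination k n g h w)

InIdeal-resp-≈P : ∀ {k n} (p q : Poly n) → p ≈P q → InIdeal k n q → InIdeal k n p
InIdeal-resp-≈P p q p≈q (g , h , e) = g , h , λ w → trans (p≈q w) (e w)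

InIdeal-zero : ∀ {k n} (p : Poly n) → (∀ w → coeff p w ≡ 0ℤ) → InIdeal k n p
InIdeal-zero {k} {n} p p≈0 = InIdeal-intro {p = p} (λ _ → []) (λ _ → [])
  (λ w → trans (p≈0 w) (sym (cong₂ _+_ (∑-zero n (λ _ → refl)) (∑-zero k (λ _ → refl)))))

xpowPart-+P : ∀ k n (g g' : Fin n → Poly n) w → xpowPart k n (λ i → g i +P g' i) w ≡ xpowPart k n g w + xpowPart k n g' w
xpowPart-+P k n g g' w = trans (sum-cong-≗ {n} (λ i → *P-distribʳ-+P (g i) (g' i) (xpow i k) w))
                               (∑-distrib-+ (λ i → coeff (g i *P xpow i k) w) (λ i → coeff (g' i *P xpow i k) w))

esymPart-+P : ∀ k n (h h' : Fin k → Poly n) w → esymPart k n (λ j → h j +P h' j) w ≡ esymPart k n h w + esymPart k n h' w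
esymPart-+P k n h h' w = trans (sum-cong-≗ {k} (λ j → *P-distribʳ-+P (h j) (h' j) (e j) w))
                               (∑-distrib-+ (λ j → coeff (h j *P e j) w) (λ j → coeff (h' j *P e j) w))
  where e = λ (j : Fin k) → esym n (n ∸ toℕ j)

InIdeal-+P : ∀ {k n} (p q : Poly n) → InIdeal k n p → InIdeal k n q → InIdeal k n (p +P q)
InIdeal-+P {k} {n} p q Ip@(g , h , _) Iq@(g' , h' , _) =
  InIdeal-intro {p = p +P q} (λ i → g i +P g' i) (λ j → h j +P h' j) λ w → begin
    coeff (p +P q) w                         ≡⟨ coeff-+P p q w ⟩
    coeff p w + coeff q w                    ≡⟨ cong₂ _+_ (InIdeal-coeff {k} {n} {p} Ip w) (InIdeal-coeff {k} {n} {q} Iq w) ⟩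
    (G g w + H h w) + (G g' w + H h' w)      ≡⟨ +-interchange (G g w) (H h w) (G g' w) (H h' w) ⟩
    (G g w + G g' w) + (H h w + H h' w)      ≡⟨ sym (cong₂ _+_ (xpowPart-+P k n g g' w) (esymPart-+P k n h h' w)) ⟩
    combinationCoeff k n (λ i → g i +P g' i) (λ j → h j +P h' j) w ∎
  where
  open ≡-Reasoning
  G = xpowPart k n
  H = esymPart k n

xpow-multiple∈I : ∀ {k n} (i : Fin n) (q : Poly n) → InIdeal k n (q *P xpow i k)
xpow-multiple∈I {k} {n} i q = InIdeal-intro {p = q *P xpow i k} g (λ _ → []) λ w →
  sym (trans (cong₂ _+_ (∑-single n _ i (others w)) (∑-zero k (λ _ → refl))) (trans (ℤP.+-identityʳ _) (at-i w)))
  where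
  g : Fin n → Poly n
  g j = if does (i Fin.≟ j) then q else []
  others : ∀ w j → j ≢ i → coeff (g j *P xpow j k) w ≡ 0ℤ
  others w j j≢i with i Fin.≟ j
  ... | yes i≡j = ⊥-elim (j≢i (sym i≡j))
  ... | no _ = refl
  at-i : ∀ w → coeff (g i *P xpow i k) w ≡ coeff (q *P xpow i k) w
  at-i w with i Fin.≟ i
  ... | yes _ = refl
  ... | no i≢i = ⊥-elim (i≢i refl)

outsideBox-split : ∀ k {n} (u : Vec ℕ n) → inBoxᵇ k u ≡ false →
                   Σ (Fin n) λ i → Σ (Vec ℕ n) λ u' → u ≡ u' +ᵥ unitV i k
outsideBox-split k (x ∷ u) u∉box with x <ᵇ k in x<ᵇk
... | true with outsideBox-split k u u∉box
...   | i , u' , refl = Fin.suc i , x ∷ u' , cong (_∷ (u' +ᵥ unitV i k)) (sym (ℕP.+-identityʳ x))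
outsideBox-split k (x ∷ u) u∉box | false =
  Fin.zero , (x ∸ k) ∷ u , cong₂ _∷_ (sym (ℕP.m∸n+n≡m k≤x)) (sym (+ᵥ-zeros u))
  where
  k≤x : k ≤ x
  k≤x = ℕP.≮⇒≥ (λ x<k → subst T x<ᵇk (ℕP.<⇒<ᵇ x<k))
  +ᵥ-zeros : ∀ {n} (u : Vec ℕ n) → u +ᵥ tabulate (λ _ → 0) ≡ u
  +ᵥ-zeros [] = refl
  +ᵥ-zeros (x ∷ u) = cong₂ _∷_ (ℕP.+-identityʳ x) (+ᵥ-zeros u)

monomial∈I : ∀ {k n} (c : ℤ) (u : Vec ℕ n) → inBoxᵇ k u ≡ false → InIdeal k n ((c , u) ∷ [])
monomial∈I {k} c u u∉box with outsideBox-split k u u∉box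
... | i , u' , refl = InIdeal-resp-≈P ((c , u) ∷ []) (((c , u') ∷ []) *P xpow i k)
                        (λ w → cong (λ c → coeff ((c , u) ∷ []) w) (sym (ℤP.*-identityʳ c)))
                                      (xpow-multiple∈I i ((c , u') ∷ []))

outsideBox∈I : ∀ {k n} (p : Poly n) → InIdeal k n (filterᵇ (λ t → not (inBoxᵇ k (proj₂ t))) p)
outsideBox∈I [] = InIdeal-zero [] (λ _ → refl)
outsideBox∈I {k} ((c , u) ∷ p) with inBoxᵇ k u in u∈box
... | true = outsideBox∈I p
... | false = InIdeal-+P ((c , u) ∷ []) (filterᵇ (λ t → not (inBoxᵇ k (proj₂ t))) p) (monomial∈I c u u∈box) (outsideBox∈I p)

coeff-filterᵇ : ∀ {n} (P : Vec ℕ n → Bool) (p : Poly n) w →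
                coeff (filterᵇ (P ∘ proj₂) p) w ≡ (if P w then coeff p w else 0ℤ)
coeff-filterᵇ P p w = begin
  coeff (filterᵇ (P ∘ proj₂) p) w                                   ≡⟨ coeff-∑ˡ (filterᵇ (P ∘ proj₂) p) w ⟩
  ∑ˡ (filterᵇ (P ∘ proj₂) p) (λ t → δ (proj₂ t) w (proj₁ t))         ≡⟨ ∑ˡ-filterᵇ _ p _ ⟩
  ∑ˡ p (λ t → if P (proj₂ t) then δ (proj₂ t) w (proj₁ t) else 0ℤ)   ≡⟨ ∑ˡ-cong p (λ t → at-w (proj₂ t) (proj₁ t)) ⟩
  ∑ˡ p (λ t → if P w then δ (proj₂ t) w (proj₁ t) else 0ℤ)           ≡⟨ ∑ˡ-if p (P w) _ ⟩
  (if P w then ∑ˡ p (λ t → δ (proj₂ t) w (proj₁ t)) else 0ℤ)         ≡⟨ BoolP.if-cong-then (P w) (sym (coeff-∑ˡ p w)) ⟩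
  (if P w then coeff p w else 0ℤ)                                   ∎
  where
  open ≡-Reasoning
  at-w : ∀ u c → (if P u then δ u w c else 0ℤ) ≡ (if P w then δ u w c else 0ℤ)
  at-w u c with VecP.≡-dec ℕ._≟_ u w
  ... | yes refl = refl
  ... | no _ with P u | P w
  ...   | true | true = refl
  ...   | true | false = refl
  ...   | false | true = refl
  ...   | false | false = refl

vanishing-on-box⇒∈I : ∀ {k n} (p : Poly n) → (∀ w → inBoxᵇ k w ≡ true → coeff p w ≡ 0ℤ) → InIdeal k n p
vanishing-on-box⇒∈I {k} p vanishes = InIdeal-resp-≈P p (filterᵇ (λ t → not (inBoxᵇ k (proj₂ t))) p) p≈outside (outsideBox∈I p)
  where
  p≈outside : p ≈P filterᵇ (λ t → not (inBoxᵇ k (proj₂ t))) p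
  p≈outside w rewrite coeff-filterᵇ (not ∘ inBoxᵇ k) p w with inBoxᵇ k w in w∈box
  ... | true = vanishes w w∈box
  ... | false = refl

coeff-difference : ∀ {n} (p q : Poly n) w → coeff (p +P (-P q)) w ≡ coeff p w + - coeff q w
coeff-difference p q w = trans (coeff-+P p (-P q) w) (cong (coeff p w +_) (coeff--P q w))

EqR-of-box-agreement : ∀ {k n} (p q : Poly n) → (∀ w → inBoxᵇ k w ≡ true → coeff p w ≡ coeff q w) → EqR k n p q
EqR-of-box-agreement p q agree = vanishing-on-box⇒∈I (p +P (-P q)) λ w w∈box →
  trans (coeff-difference p q w) (trans (cong (_+ - coeff q w) (agree w w∈box)) (ℤP.+-inverseʳ (coeff q w)))

EqR-trans : ∀ {k n} (p q r : Poly n) → EqR k n p q → EqR k n q r → EqR k n p r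
EqR-trans p q r p~q q~r = InIdeal-resp-≈P (p +P (-P r)) ((p +P (-P q)) +P (q +P (-P r))) telescope
                                           (InIdeal-+P (p +P (-P q)) (q +P (-P r)) p~q q~r)
  where
  telescope : (p +P (-P r)) ≈P ((p +P (-P q)) +P (q +P (-P r)))
  telescope w rewrite coeff-+P (p +P (-P q)) (q +P (-P r)) w
                    | coeff-difference p r w | coeff-difference p q w | coeff-difference q r w =
    ℤ-telescope (coeff p w) (coeff q w) (coeff r w)
    where
    ℤ-telescope : ∀ x y z → x + - z ≡ (x + - y) + (y + - z)
    ℤ-telescope = solve-∀

-- Box coefficients of ideal elements in low degree

inBoxᵇ-∸ᵥ : ∀ {k n} (w u : Vec ℕ n) → inBoxᵇ k w ≡ true → inBoxᵇ k (w ∸ᵥ u) ≡ true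
inBoxᵇ-∸ᵥ [] [] _ = refl
inBoxᵇ-∸ᵥ {k} (x ∷ w) (y ∷ u) x∷w∈box =
  cong₂ _∧_ (T⇒true (ℕP.<⇒<ᵇ (ℕP.≤-<-trans (ℕP.m∸n≤m x y) (inBoxᵇ-head k x w x∷w∈box))))
            (inBoxᵇ-∸ᵥ w u (inBoxᵇ-tail k x w x∷w∈box))

n<ᵇn : ∀ n → (n <ᵇ n) ≡ false
n<ᵇn zero = refl
n<ᵇn (suc n) = n<ᵇn n

unitV∉box : ∀ {n} (i : Fin n) k → inBoxᵇ k (unitV i k) ≡ false
unitV∉box Fin.zero k rewrite n<ᵇn k = refl
unitV∉box (Fin.suc i) k rewrite unitV∉box i k = BoolP.∧-zeroʳ _

vsum-∸ᵥ : ∀ {n} (w u : Vec ℕ n) → vsum (w ∸ᵥ u) ≤ vsum w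
vsum-∸ᵥ [] [] = z≤n
vsum-∸ᵥ (x ∷ w) (y ∷ u) = ℕP.+-mono-≤ (ℕP.m∸n≤m x y) (vsum-∸ᵥ w u)

≢⇒≡ᵇ-false : ∀ {a b} → a ≢ b → (a ≡ᵇ b) ≡ false
≢⇒≡ᵇ-false {a} {b} a≢b with a ≡ᵇ b in a≡ᵇb
... | true = ⊥-elim (a≢b (ℕP.≡ᵇ⇒≡ a b (true⇒T a≡ᵇb)))
... | false = refl

*P-vanishes : ∀ {n} (q r : Poly n) w → (∀ u → u ≤ᵥᵇ w ≡ true → coeff r (w ∸ᵥ u) ≡ 0ℤ) → coeff (q *P r) w ≡ 0ℤ
*P-vanishes q r w r-vanishes = trans (coeff-*P q r w) (∑ˡ-zero q λ (c , u) → trans (cong (c *_) (term u)) (ℤP.*-zeroʳ c))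
  where
  term : ∀ u → (if u ≤ᵥᵇ w then coeff r (w ∸ᵥ u) else 0ℤ) ≡ 0ℤ
  term u with u ≤ᵥᵇ w in u≤w
  ... | true = r-vanishes u u≤w
  ... | false = refl

xpow-multiple-vanishes-on-box : ∀ {k n} (q : Poly n) (i : Fin n) w → inBoxᵇ k w ≡ true → coeff (q *P xpow i k) w ≡ 0ℤ
xpow-multiple-vanishes-on-box {k} q i w w∈box = *P-vanishes q (xpow i k) w λ u _ →
  trans (coeff-xpow i k (w ∸ᵥ u)) (δ-≢ {u = unitV i k} {w ∸ᵥ u} λ unit≡w∸u →
    case trans (sym (unitV∉box i k)) (trans (cong (inBoxᵇ k) unit≡w∸u) (inBoxᵇ-∸ᵥ w u w∈box)) of λ ())

esym-multiple-vanishes-below : ∀ {n} (q : Poly n) d w → vsum w < d → coeff (q *P esym n d) w ≡ 0ℤ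
esym-multiple-vanishes-below {n} q d w w<d = *P-vanishes q (esym n d) w λ u _ →
  trans (coeff-esym n d (w ∸ᵥ u))
        (trans (BoolP.if-cong-then (inBoxᵇ 2 (w ∸ᵥ u)) (BoolP.if-cong (≢⇒≡ᵇ-false (ℕP.<⇒≢ (ℕP.≤-<-trans (vsum-∸ᵥ w u) w<d)))))
               (BoolP.if-eta (inBoxᵇ 2 (w ∸ᵥ u))))

InIdeal⇒box-coeff≡0 : ∀ {k n} (p : Poly n) → InIdeal k n p →
                      ∀ w → inBoxᵇ k w ≡ true → vsum w ℕ.+ k ≤ n → coeff p w ≡ 0ℤ
InIdeal⇒box-coeff≡0 {k} {n} p I@(g , h , _) w w∈box |w|+k≤n =
  trans (InIdeal-coeff {k} {n} {p} I w)
        (cong₂ _+_ (∑-zero n (λ i → xpow-multiple-vanishes-on-box (g i) i w w∈box))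
                   (∑-zero k (λ j → esym-multiple-vanishes-below (h j) _ w (degree-bound j))))
  where
  degree-bound : (j : Fin k) → vsum w < n ∸ toℕ j
  degree-bound j = ℕP.m+n≤o⇒m≤o∸n (suc (vsum w)) (begin
    suc (vsum w) ℕ.+ toℕ j  ≡⟨ ℕP.+-suc (vsum w) (toℕ j) ⟨
    vsum w ℕ.+ suc (toℕ j)  ≤⟨ ℕP.+-monoʳ-≤ (vsum w) (FinP.toℕ<n j) ⟩
    vsum w ℕ.+ k            ≤⟨ |w|+k≤n ⟩
    n                       ∎)
    where open ℕP.≤-Reasoning

EqR⇒box-coeff≡ : ∀ {k n} (p q : Poly n) → EqR k n p q →
                 ∀ w → inBoxᵇ k w ≡ true → vsum w ℕ.+ k ≤ n → coeff p w ≡ coeff q w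
EqR⇒box-coeff≡ p q p~q w w∈box |w|+k≤n = ℤP.i-j≡0⇒i≡j (coeff p w) (coeff q w)
  (trans (sym (coeff-difference p q w)) (InIdeal⇒box-coeff≡0 (p +P (-P q)) p~q w w∈box |w|+k≤n))

-- Setting the last variable to zero

coeff-proj : ∀ {n} (p : Poly (suc n)) w → coeff (proj p) w ≡ coeff p (w ∷ʳ 0)
coeff-proj p w = begin
  coeff (proj p) w                                                      ≡⟨ coeff-∑ˡ (proj p) w ⟩
  _                                                                     ≡⟨ ∑ˡ-map _ (filterᵇ _ p) _ ⟩
  _                                                                     ≡⟨ ∑ˡ-filterᵇ _ p _ ⟩
  ∑ˡ p (λ t → if last (proj₂ t) ≡ᵇ 0 then δ (init (proj₂ t)) w (proj₁ t) else 0ℤ)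
    ≡⟨ ∑ˡ-cong p (λ t → δ-∷ʳ0 (proj₂ t) (proj₁ t)) ⟩
  ∑ˡ p (λ t → δ (proj₂ t) (w ∷ʳ 0) (proj₁ t))                           ≡⟨ sym (coeff-∑ˡ p (w ∷ʳ 0)) ⟩
  coeff p (w ∷ʳ 0)                                                      ∎
  where
  open ≡-Reasoning
  δ-∷ʳ0 : ∀ u c → (if last u ≡ᵇ 0 then δ (init u) w c else 0ℤ) ≡ δ u (w ∷ʳ 0) c
  δ-∷ʳ0 u c with initLast u
  ... | v , zero , refl = sym (δ-∷ʳ v w 0 c)
  ... | v , suc x , refl = sym (δ-≢ {u = v ∷ʳ suc x} {w ∷ʳ 0} (λ eq → case VecP.∷ʳ-injectiveʳ v w eq of λ ()))

≤ᵥᵇ-∷ʳ : ∀ {n} (u v : Vec ℕ n) x y → (u ∷ʳ x) ≤ᵥᵇ (v ∷ʳ y) ≡ (u ≤ᵥᵇ v) ∧ (x ≤ᵇ y)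
≤ᵥᵇ-∷ʳ [] [] x y = BoolP.∧-identityʳ _
≤ᵥᵇ-∷ʳ (a ∷ u) (b ∷ v) x y rewrite ≤ᵥᵇ-∷ʳ u v x y = sym (BoolP.∧-assoc (a ≤ᵇ b) _ _)

∸ᵥ-∷ʳ : ∀ {n} (u v : Vec ℕ n) x y → (u ∷ʳ x) ∸ᵥ (v ∷ʳ y) ≡ (u ∸ᵥ v) ∷ʳ (x ∸ y)
∸ᵥ-∷ʳ [] [] x y = refl
∸ᵥ-∷ʳ (a ∷ u) (b ∷ v) x y = cong ((a ∸ b) ∷_) (∸ᵥ-∷ʳ u v x y)

proj-*P : ∀ {n} (p q : Poly (suc n)) → proj (p *P q) ≈P (proj p *P proj q)
proj-*P p q w = begin
  coeff (proj (p *P q)) w                  ≡⟨ coeff-proj (p *P q) w ⟩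
  coeff (p *P q) (w ∷ʳ 0)                  ≡⟨ coeff-*P p q (w ∷ʳ 0) ⟩
  ∑ˡ p (λ s → proj₁ s * (if proj₂ s ≤ᵥᵇ (w ∷ʳ 0) then coeff q ((w ∷ʳ 0) ∸ᵥ proj₂ s) else 0ℤ))
    ≡⟨ ∑ˡ-cong p (λ s → term (proj₂ s) (proj₁ s)) ⟩
  ∑ˡ p (λ s → if last (proj₂ s) ≡ᵇ 0 then proj₁ s * (if init (proj₂ s) ≤ᵥᵇ w then coeff (proj q) (w ∸ᵥ init (proj₂ s)) else 0ℤ) else 0ℤ)
    ≡⟨ sym (trans (∑ˡ-map _ (filterᵇ _ p) _) (∑ˡ-filterᵇ _ p _)) ⟩
  ∑ˡ (proj p) (λ s → proj₁ s * (if proj₂ s ≤ᵥᵇ w then coeff (proj q) (w ∸ᵥ proj₂ s) else 0ℤ))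
    ≡⟨ sym (coeff-*P (proj p) (proj q) w) ⟩
  coeff (proj p *P proj q) w               ∎
  where
  open ≡-Reasoning
  term : ∀ u c → c * (if u ≤ᵥᵇ (w ∷ʳ 0) then coeff q ((w ∷ʳ 0) ∸ᵥ u) else 0ℤ)
               ≡ (if last u ≡ᵇ 0 then c * (if init u ≤ᵥᵇ w then coeff (proj q) (w ∸ᵥ init u) else 0ℤ) else 0ℤ)
  term u c with initLast u
  ... | v , x , refl rewrite ≤ᵥᵇ-∷ʳ v w x 0 | ∸ᵥ-∷ʳ w v 0 x with x
  ...   | zero rewrite BoolP.∧-identityʳ (v ≤ᵥᵇ w) | coeff-proj q (w ∸ᵥ v) = refl
  ...   | suc _ rewrite BoolP.∧-zeroʳ (v ≤ᵥᵇ w) = ℤP.*-zeroʳ c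

unitV-inject₁ : ∀ {n} (i : Fin n) k → unitV (inject₁ i) k ≡ unitV i k ∷ʳ 0
unitV-inject₁ {suc n} Fin.zero k = cong (k ∷_) (zeros-∷ʳ n)
  where
  zeros-∷ʳ : ∀ n → tabulate {n = suc n} (λ _ → 0) ≡ tabulate {n = n} (λ _ → 0) ∷ʳ 0
  zeros-∷ʳ zero = refl
  zeros-∷ʳ (suc n) = cong (0 ∷_) (zeros-∷ʳ n)
unitV-inject₁ {suc n} (Fin.suc i) k = cong (0 ∷_) (unitV-inject₁ i k)

unitV-fromℕ : ∀ n k → unitV (fromℕ n) k ≡ tabulate {n = n} (λ _ → 0) ∷ʳ k
unitV-fromℕ zero k = refl
unitV-fromℕ (suc n) k = cong (0 ∷_) (unitV-fromℕ n k)

proj-xpow-inject₁ : ∀ {n} (i : Fin n) k → proj (xpow (inject₁ i) k) ≈P xpow i k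
proj-xpow-inject₁ i k w rewrite coeff-proj (xpow (inject₁ i) k) w | coeff-xpow (inject₁ i) k (w ∷ʳ 0)
                              | coeff-xpow i k w | unitV-inject₁ i k = δ-∷ʳ (unitV i k) w 0 1ℤ

proj-xpow-fromℕ : ∀ n k → 1 ≤ k → proj (xpow (fromℕ n) k) ≈P []
proj-xpow-fromℕ n (suc k) _ w rewrite coeff-proj (xpow (fromℕ n) (suc k)) w | coeff-xpow (fromℕ n) (suc k) (w ∷ʳ 0)
                                    | unitV-fromℕ n (suc k) =
  δ-≢ {u = tabulate (λ _ → 0) ∷ʳ suc k} {w ∷ʳ 0} (λ eq → case VecP.∷ʳ-injectiveʳ _ w eq of λ ())

inBoxᵇ-∷ʳ : ∀ {n} k (v : Vec ℕ n) x → inBoxᵇ k (v ∷ʳ x) ≡ inBoxᵇ k v ∧ (x <ᵇ k)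
inBoxᵇ-∷ʳ k [] x = BoolP.∧-identityʳ _
inBoxᵇ-∷ʳ k (a ∷ v) x rewrite inBoxᵇ-∷ʳ k v x = sym (BoolP.∧-assoc (a <ᵇ k) _ _)

vsum-∷ʳ : ∀ {n} (v : Vec ℕ n) x → vsum (v ∷ʳ x) ≡ vsum v ℕ.+ x
vsum-∷ʳ [] x = ℕP.+-identityʳ x
vsum-∷ʳ (a ∷ v) x rewrite vsum-∷ʳ v x = sym (ℕP.+-assoc a _ x)

proj-esym : ∀ n d → proj (esym (suc n) d) ≈P esym n d
proj-esym n d w rewrite coeff-proj (esym (suc n) d) w | coeff-esym (suc n) d (w ∷ʳ 0) | coeff-esym n d w
                      | inBoxᵇ-∷ʳ 2 w 0 | vsum-∷ʳ w 0 | ℕP.+-identityʳ (vsum w) | BoolP.∧-identityʳ (inBoxᵇ 2 w) = refl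

vsum-inBoxᵇ : ∀ {n} k (v : Vec ℕ n) → inBoxᵇ k v ≡ true → vsum v ≤ n ℕ.* ℕ.pred k
vsum-inBoxᵇ k [] _ = z≤n
vsum-inBoxᵇ k (x ∷ v) x∷v∈box =
  ℕP.+-mono-≤ (ℕP.<⇒≤pred (inBoxᵇ-head k x v x∷v∈box)) (vsum-inBoxᵇ k v (inBoxᵇ-tail k x v x∷v∈box))

esym-above-n : ∀ n → esym n (suc n) ≈P []
esym-above-n n w rewrite coeff-esym n (suc n) w with inBoxᵇ 2 w in w∈box
... | false = refl
... | true rewrite ≢⇒≡ᵇ-false (ℕP.<⇒≢ (s≤s (subst (vsum w ≤_) (ℕP.*-identityʳ n) (vsum-inBoxᵇ 2 w w∈box)))) = refl

_∷ʳᶠ_ : ∀ {A : Set} {n} → (Fin n → A) → A → Fin (suc n) → A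
_∷ʳᶠ_ {n = zero} h a _ = a
_∷ʳᶠ_ {n = suc n} h a Fin.zero = h Fin.zero
_∷ʳᶠ_ {n = suc n} h a (Fin.suc i) = ((h ∘ Fin.suc) ∷ʳᶠ a) i

∷ʳᶠ-inject₁ : ∀ {A : Set} {n} (h : Fin n → A) a i → (h ∷ʳᶠ a) (inject₁ i) ≡ h i
∷ʳᶠ-inject₁ {n = suc n} h a Fin.zero = refl
∷ʳᶠ-inject₁ {n = suc n} h a (Fin.suc i) = ∷ʳᶠ-inject₁ (h ∘ Fin.suc) a i

∷ʳᶠ-fromℕ : ∀ {A : Set} {n} (h : Fin n → A) a → (h ∷ʳᶠ a) (fromℕ n) ≡ a
∷ʳᶠ-fromℕ {n = zero} h a = refl
∷ʳᶠ-fromℕ {n = suc n} h a = ∷ʳᶠ-fromℕ (h ∘ Fin.suc) a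

coeff-*P-∷ʳ0 : ∀ {n} (r s : Poly (suc n)) w → coeff (r *P s) (w ∷ʳ 0) ≡ coeff (proj r *P proj s) w
coeff-*P-∷ʳ0 r s w = trans (sym (coeff-proj (r *P s) w)) (proj-*P r s w)

-- x_{m+1}^k and e_{m+1} die, the other generators of I_{m+1,k} become those of I_{m,k}; the last
-- generator e_{m+1-k} of I_{m,k} gets coefficient 0.
proj-∈I : ∀ {k m} → 1 ≤ k → (p : Poly (suc m)) → InIdeal k (suc m) p → InIdeal k m (proj p)
proj-∈I {suc k'} {m} 1≤k p I@(g , h , _) = InIdeal-intro {p = proj p} g' h' λ w → begin
  coeff (proj p) w                                               ≡⟨ coeff-proj p w ⟩
  coeff p (w ∷ʳ 0)                                               ≡⟨ InIdeal-coeff {k} {suc m} {p} I (w ∷ʳ 0) ⟩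
  xpowPart k (suc m) g (w ∷ʳ 0) + esymPart k (suc m) h (w ∷ʳ 0)  ≡⟨ cong₂ _+_ (xpowPart-proj w) (esymPart-proj w) ⟩
  xpowPart k m g' w + esymPart k m h' w                          ∎
  where
  open ≡-Reasoning
  k = suc k'
  g' : Fin m → Poly m
  g' i = proj (g (inject₁ i))
  h' : Fin k → Poly m
  h' = (λ j → proj (h (Fin.suc j))) ∷ʳᶠ []
  xpowPart-proj : ∀ w → xpowPart k (suc m) g (w ∷ʳ 0) ≡ xpowPart k m g' w
  xpowPart-proj w = begin
    xpowPart k (suc m) g (w ∷ʳ 0)
      ≡⟨ sum-init-last (λ i → coeff (g i *P xpow i k) (w ∷ʳ 0)) ⟩
    ∑[ i < m ] coeff (g (inject₁ i) *P xpow (inject₁ i) k) (w ∷ʳ 0) + coeff (g (fromℕ m) *P xpow (fromℕ m) k) (w ∷ʳ 0)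
      ≡⟨ cong₂ _+_ (sum-cong-≗ {m} (λ i → trans (coeff-*P-∷ʳ0 (g (inject₁ i)) _ w) (*P-congʳ (g' i) (proj-xpow-inject₁ i k) w)))
                   (trans (coeff-*P-∷ʳ0 (g (fromℕ m)) _ w)
                          (trans (*P-congʳ gₗ (proj-xpow-fromℕ m k 1≤k) w) (*P-zeroʳ gₗ w))) ⟩
    xpowPart k m g' w + 0ℤ
      ≡⟨ ℤP.+-identityʳ _ ⟩
    xpowPart k m g' w ∎
    where gₗ = proj (g (fromℕ m))
  esymPart-proj : ∀ w → esymPart k (suc m) h (w ∷ʳ 0) ≡ esymPart k m h' w
  esymPart-proj w = begin
    coeff (h Fin.zero *P esym (suc m) (suc m)) (w ∷ʳ 0) + ∑[ j < k' ] coeff (h (Fin.suc j) *P esym (suc m) (m ∸ toℕ j)) (w ∷ʳ 0)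
      ≡⟨ cong₂ _+_ (trans (coeff-*P-∷ʳ0 (h Fin.zero) _ w)
                          (trans (*P-congʳ h₀ (λ v → trans (proj-esym m (suc m) v) (esym-above-n m v)) w) (*P-zeroʳ h₀ w)))
                   (sum-cong-≗ {k'} λ j → trans (coeff-*P-∷ʳ0 (h (Fin.suc j)) _ w)
                     (trans (*P-congʳ (proj (h (Fin.suc j))) (proj-esym m (m ∸ toℕ j)) w)
                     (cong₂ (λ r d → coeff (r *P esym m (m ∸ d)) w) (sym (∷ʳᶠ-inject₁ _ [] j)) (sym (FinP.toℕ-inject₁ j))))) ⟩
    0ℤ + S                                                  ≡⟨ ℤP.+-comm 0ℤ S ⟩
    S + 0ℤ                                                  ≡⟨ cong (S +_) (sym last-term) ⟩
    S + coeff (h' (fromℕ k') *P esym m (m ∸ toℕ (fromℕ k'))) w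
      ≡⟨ sym (sum-init-last (λ j → coeff (h' j *P esym m (m ∸ toℕ j)) w)) ⟩
    esymPart k m h' w ∎
    where
    h₀ = proj (h Fin.zero)
    S = ∑[ j < k' ] coeff (h' (inject₁ j) *P esym m (m ∸ toℕ (inject₁ j))) w
    last-term : coeff (h' (fromℕ k') *P esym m (m ∸ toℕ (fromℕ k'))) w ≡ 0ℤ
    last-term = cong (λ r → coeff (r *P esym m (m ∸ toℕ (fromℕ k'))) w) (∷ʳᶠ-fromℕ (λ j → proj (h (Fin.suc j))) [])

proj-EqR : ∀ {k m} → 1 ≤ k → (p q : Poly (suc m)) → EqR k (suc m) p q → EqR k m (proj p) (proj q)
proj-EqR 1≤k p q p~q = InIdeal-resp-≈P (proj p +P (-P proj q)) (proj (p +P (-P q))) proj-difference (proj-∈I 1≤k (p +P (-P q)) p~q)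
  where
  proj-difference : (proj p +P (-P proj q)) ≈P proj (p +P (-P q))
  proj-difference w rewrite coeff-difference (proj p) (proj q) w | coeff-proj (p +P (-P q)) w
                          | coeff-difference p q (w ∷ʳ 0) | coeff-proj p w | coeff-proj q w = refl

projs : ∀ {n} d → Poly (d ℕ.+ n) → Poly n
projs zero p = p
projs (suc d) p = projs d (proj p)

padZeros : ∀ {n} d → Vec ℕ n → Vec ℕ (d ℕ.+ n)
padZeros zero w = w
padZeros (suc d) w = padZeros d w ∷ʳ 0

coeff-projs : ∀ {n} d (p : Poly (d ℕ.+ n)) w → coeff (projs d p) w ≡ coeff p (padZeros d w)
coeff-projs zero p w = refl
coeff-projs (suc d) p w = trans (coeff-projs d (proj p) w) (coeff-proj p (padZeros d w))

projs-EqR : ∀ {k n} → 1 ≤ k → ∀ d (p q : Poly (d ℕ.+ n)) → EqR k (d ℕ.+ n) p q → EqR k n (projs d p) (projs d q)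
projs-EqR 1≤k zero p q p~q = p~q
projs-EqR 1≤k (suc d) p q p~q = projs-EqR 1≤k d (proj p) (proj q) (proj-EqR 1≤k p q p~q)

-- Truncation of series

strip-cons0 : ∀ a s → strip (cons0 a s) ≡ cons0 a (strip s)
strip-cons0 zero [] = refl
strip-cons0 zero (x ∷ s) = refl
strip-cons0 (suc a) s = refl

strip-idem : ∀ l → strip (strip l) ≡ strip l
strip-idem [] = refl
strip-idem (a ∷ l) = trans (strip-cons0 a (strip l)) (cong (cons0 a) (strip-idem l))

scoeff-strip : ∀ f l → scoeff f (strip l) ≡ scoeff f l
scoeff-strip f l = cong f (strip-idem l)

strip-∷ʳ0 : ∀ {n} (v : Vec ℕ n) → strip (toList (v ∷ʳ 0)) ≡ strip (toList v)
strip-∷ʳ0 v = trans (cong strip (VecP.toList-∷ʳ 0 v)) (strip-++0 (toList v))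
  where
  strip-++0 : ∀ l → strip (l ++ (0 ∷ [])) ≡ strip l
  strip-++0 [] = refl
  strip-++0 (a ∷ l) = cong (cons0 a) (strip-++0 l)

strip-zeros : ∀ n → strip (toList (replicate n 0)) ≡ []
strip-zeros zero = refl
strip-zeros (suc n) rewrite strip-zeros n = refl

strip≡[]⇒zeros : ∀ {n} (w : Vec ℕ n) → strip (toList w) ≡ [] → w ≡ replicate n 0
strip≡[]⇒zeros [] _ = refl
strip≡[]⇒zeros (x ∷ w) eq with strip (toList w) in e
strip≡[]⇒zeros (zero ∷ w) eq | [] = cong (0 ∷_) (strip≡[]⇒zeros w e)

inBoxᵇ⇒All : ∀ {k n} (w : Vec ℕ n) → inBoxᵇ k w ≡ true → All (_< k) (toList w)
inBoxᵇ⇒All [] _ = []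
inBoxᵇ⇒All {k} (x ∷ w) x∷w∈box = inBoxᵇ-head k x w x∷w∈box ∷ inBoxᵇ⇒All w (inBoxᵇ-tail k x w x∷w∈box)

coeff-trunc-inBox : ∀ {k n} f (w : Vec ℕ n) → inBoxᵇ k w ≡ true → coeff (trunc k n f) w ≡ scoeff f (toList w)
coeff-trunc-inBox {k} {n} f w w∈box = trans (coeff-trunc k n f w) (BoolP.if-cong w∈box)

trunc-resp-≈ : ∀ {k} n (f g : Series) → f ≈[P k ] g → EqR k n (trunc k n f) (trunc k n g)
trunc-resp-≈ n f g f≈g = EqR-of-box-agreement (trunc _ n f) (trunc _ n g) λ w w∈box →
  trans (coeff-trunc-inBox f w w∈box) (trans (f≈g (toList w) (inBoxᵇ⇒All w w∈box)) (sym (coeff-trunc-inBox g w w∈box)))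

trunc-+S : ∀ k n (f g : Series) → EqR k n (trunc k n (f +S g)) (trunc k n f +P trunc k n g)
trunc-+S k n f g = EqR-of-box-agreement (trunc k n (f +S g)) (trunc k n f +P trunc k n g) λ w w∈box → begin
  coeff (trunc k n (f +S g)) w                        ≡⟨ coeff-trunc-inBox (f +S g) w w∈box ⟩
  scoeff f (strip (toList w)) + scoeff g (strip (toList w)) ≡⟨ cong₂ _+_ (scoeff-strip f (toList w)) (scoeff-strip g (toList w)) ⟩
  scoeff f (toList w) + scoeff g (toList w)           ≡⟨ sym (cong₂ _+_ (coeff-trunc-inBox f w w∈box) (coeff-trunc-inBox g w w∈box)) ⟩
  coeff (trunc k n f) w + coeff (trunc k n g) w       ≡⟨ sym (coeff-+P (trunc k n f) (trunc k n g) w) ⟩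
  coeff (trunc k n f +P trunc k n g) w                ∎
  where open ≡-Reasoning

trunc-1S : ∀ k n → EqR k n (trunc k n 1S) 1P
trunc-1S k n = EqR-of-box-agreement (trunc k n 1S) 1P λ w w∈box →
  trans (coeff-trunc-inBox 1S w w∈box) (trans (one w) (sym (coeff-1P w)))
  where
  one : ∀ (w : Vec ℕ n) → scoeff 1S (toList w) ≡ δ (replicate n 0) w 1ℤ
  one w rewrite strip-idem (toList w) with strip (toList w) in e
  ... | [] = sym (δ-≡ (sym (strip≡[]⇒zeros w e)))
  ... | _ ∷ _ = sym (δ-≢ {u = replicate n 0} {w} λ zeros≡w →
    case trans (sym e) (trans (cong (strip ∘ toList) (sym zeros≡w)) (strip-zeros n)) of λ ())

proj-trunc : ∀ k → 1 ≤ k → ∀ n (f : Series) → EqR k n (proj (trunc k (suc n) f)) (trunc k n f)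
proj-trunc (suc k) 1≤k n f = EqR-of-box-agreement (proj (trunc (suc k) (suc n) f)) (trunc (suc k) n f) λ w w∈box →
  trans (coeff-proj (trunc (suc k) (suc n) f) w)
        (trans (coeff-trunc-inBox f (w ∷ʳ 0) (trans (inBoxᵇ-∷ʳ (suc k) w 0) (cong (_∧ true) w∈box)))
               (trans (cong f (strip-∷ʳ0 w)) (sym (coeff-trunc-inBox f w w∈box))))

∑ˡ-splits-∷ : ∀ x m (Ψ : List ℕ × List ℕ → ℤ) →
              ∑ˡ (splits (x ∷ m)) Ψ ≡ ∑[ i < suc x ] ∑ˡ (splits m) (λ ab → Ψ (toℕ i ∷ proj₁ ab , (x ∸ toℕ i) ∷ proj₂ ab))
∑ˡ-splits-∷ x m Ψ =
  trans (∑ˡ-concatMap (λ i → map (prepend i) (splits m)) (upTo (suc x)) Ψ)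
        (trans (∑ˡ-upTo (suc x) (λ i → ∑ˡ (map (prepend i) (splits m)) Ψ))
               (sum-cong-≗ {suc x} (λ i → ∑ˡ-map (prepend (toℕ i)) (splits m) Ψ)))
  where
  prepend : ℕ → List ℕ × List ℕ → List ℕ × List ℕ
  prepend i ab = i ∷ proj₁ ab , (x ∸ i) ∷ proj₂ ab

∑ˡ-splits-strip : ∀ m (Ψ : List ℕ × List ℕ → ℤ) → (∀ a b → Ψ (a , b) ≡ Ψ (strip a , strip b)) →
                  ∑ˡ (splits m) Ψ ≡ ∑ˡ (splits (strip m)) Ψ
∑ˡ-splits-strip [] Ψ Ψ-strip = refl
∑ˡ-splits-strip (x ∷ m) Ψ Ψ-strip =
  trans (∑ˡ-splits-∷ x m Ψ)
        (trans (sum-cong-≗ {suc x} (λ i → ∑ˡ-splits-strip m _ (Ψ-strip-tail (toℕ i))))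
               (trans (sym (∑ˡ-splits-∷ x (strip m) Ψ)) (cons-cons0 x (strip m))))
  where
  Ψ-strip-tail : ∀ i a b → Ψ (i ∷ a , (x ∸ i) ∷ b) ≡ Ψ (i ∷ strip a , (x ∸ i) ∷ strip b)
  Ψ-strip-tail i a b = trans (Ψ-strip (i ∷ a) ((x ∸ i) ∷ b))
    (sym (trans (Ψ-strip (i ∷ strip a) ((x ∸ i) ∷ strip b))
                (cong₂ (λ a' b' → Ψ (cons0 i a' , cons0 (x ∸ i) b')) (strip-idem a) (strip-idem b))))
  cons-cons0 : ∀ y s → ∑ˡ (splits (y ∷ s)) Ψ ≡ ∑ˡ (splits (cons0 y s)) Ψ
  cons-cons0 zero [] = cong (_+ 0ℤ) (Ψ-strip (0 ∷ []) (0 ∷ []))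
  cons-cons0 zero (_ ∷ _) = refl
  cons-cons0 (suc y) s = refl

∑ˡ-boxVecs-splits : ∀ k n (Φ : List ℕ × List ℕ → ℤ) (w : Vec ℕ n) → inBoxᵇ k w ≡ true →
                    ∑ˡ (boxVecs k n) (λ u → if u ≤ᵥᵇ w then Φ (toList u , toList (w ∸ᵥ u)) else 0ℤ)
                    ≡ ∑ˡ (splits (toList w)) Φ
∑ˡ-boxVecs-splits k zero Φ [] _ = refl
∑ˡ-boxVecs-splits k (suc n) Φ (x ∷ w) x∷w∈box = begin
  ∑ˡ (boxVecs k (suc n)) (λ u → if u ≤ᵥᵇ (x ∷ w) then Φ (toList u , toList ((x ∷ w) ∸ᵥ u)) else 0ℤ)
    ≡⟨ trans (∑ˡ-concatMap _ (upTo k) _) (∑ˡ-upTo k _) ⟩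
  ∑[ a < k ] ∑ˡ (map (toℕ a ∷_) (boxVecs k n)) (λ u → if u ≤ᵥᵇ (x ∷ w) then Φ (toList u , toList ((x ∷ w) ∸ᵥ u)) else 0ℤ)
    ≡⟨ sum-cong-≗ {k} (λ a → trans (∑ˡ-map _ (boxVecs k n) _)
                                  (trans (∑ˡ-cong (boxVecs k n) (λ v → BoolP.if-∧ (toℕ a ≤ᵇ x)))
                                         (∑ˡ-if (boxVecs k n) (toℕ a ≤ᵇ x) _))) ⟩
  ∑[ a < k ] (if toℕ a ≤ᵇ x then ∑ˡ (boxVecs k n) (λ v → if v ≤ᵥᵇ w then Φ (toℕ a ∷ toList v , (x ∸ toℕ a) ∷ toList (w ∸ᵥ v)) else 0ℤ) else 0ℤ)
    ≡⟨ sum-cong-≗ {k} (λ a → BoolP.if-cong-then (toℕ a ≤ᵇ x)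
                                  (∑ˡ-boxVecs-splits k n (λ bc → Φ (toℕ a ∷ proj₁ bc , (x ∸ toℕ a) ∷ proj₂ bc)) w w∈box)) ⟩
  ∑[ a < k ] (if toℕ a ≤ᵇ x then ∑ˡ (splits (toList w)) (λ bc → Φ (toℕ a ∷ proj₁ bc , (x ∸ toℕ a) ∷ proj₂ bc)) else 0ℤ)
    ≡⟨ ∑-≤ᵇ k x (λ a → ∑ˡ (splits (toList w)) (λ bc → Φ (a ∷ proj₁ bc , (x ∸ a) ∷ proj₂ bc))) x<k ⟩
  ∑[ a < suc x ] ∑ˡ (splits (toList w)) (λ bc → Φ (toℕ a ∷ proj₁ bc , (x ∸ toℕ a) ∷ proj₂ bc))
    ≡⟨ sym (∑ˡ-splits-∷ x (toList w) Φ) ⟩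
  ∑ˡ (splits (toList (x ∷ w))) Φ ∎
  where
  open ≡-Reasoning
  w∈box = inBoxᵇ-tail k x w x∷w∈box
  x<k = inBoxᵇ-head k x w x∷w∈box
  ∑-≤ᵇ : ∀ k x (T : ℕ → ℤ) → x < k → ∑[ a < k ] (if toℕ a ≤ᵇ x then T (toℕ a) else 0ℤ) ≡ ∑[ a < suc x ] T (toℕ a)
  ∑-≤ᵇ (suc k) zero T _ = cong (T 0 +_) (∑-zero k (λ _ → refl))
  ∑-≤ᵇ (suc k) (suc x) T (s≤s x<k) = cong (T 0 +_)
    (trans (sum-cong-≗ {k} (λ a → BoolP.if-cong (≤ᵇ-suc (toℕ a))))
           (∑-≤ᵇ k x (T ∘ suc) x<k))
    where
    ≤ᵇ-suc : ∀ a → (suc a ≤ᵇ suc x) ≡ (a ≤ᵇ x)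
    ≤ᵇ-suc zero = refl
    ≤ᵇ-suc (suc a) = refl

trunc-*S : ∀ k n (f g : Series) → EqR k n (trunc k n (f *S g)) (trunc k n f *P trunc k n g)
trunc-*S k n f g = EqR-of-box-agreement (trunc k n (f *S g)) (trunc k n f *P trunc k n g) box-coeff
  where
  Φ : List ℕ × List ℕ → ℤ
  Φ (a , b) = scoeff f a * scoeff g b
  box-coeff : ∀ w → inBoxᵇ k w ≡ true → coeff (trunc k n (f *S g)) w ≡ coeff (trunc k n f *P trunc k n g) w
  box-coeff w w∈box = begin
    coeff (trunc k n (f *S g)) w
      ≡⟨ coeff-trunc-inBox (f *S g) w w∈box ⟩
    ∑ˡ (splits (strip (strip (toList w)))) Φ
      ≡⟨ cong (λ l → ∑ˡ (splits l) Φ) (strip-idem (toList w)) ⟩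
    ∑ˡ (splits (strip (toList w))) Φ
      ≡⟨ sym (∑ˡ-splits-strip (toList w) Φ (λ a b → sym (cong₂ _*_ (scoeff-strip f a) (scoeff-strip g b)))) ⟩
    ∑ˡ (splits (toList w)) Φ
      ≡⟨ sym (∑ˡ-boxVecs-splits k n Φ w w∈box) ⟩
    ∑ˡ (boxVecs k n) (λ u → if u ≤ᵥᵇ w then Φ (toList u , toList (w ∸ᵥ u)) else 0ℤ)
      ≡⟨ ∑ˡ-cong (boxVecs k n) term ⟩
    ∑ˡ (boxVecs k n) (λ u → scoeff f (toList u) * (if u ≤ᵥᵇ w then coeff (trunc k n g) (w ∸ᵥ u) else 0ℤ))
      ≡⟨ sym (trans (coeff-*P (trunc k n f) (trunc k n g) w) (∑ˡ-map _ (boxVecs k n) _)) ⟩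
    coeff (trunc k n f *P trunc k n g) w ∎
    where
    open ≡-Reasoning
    term : ∀ u → (if u ≤ᵥᵇ w then Φ (toList u , toList (w ∸ᵥ u)) else 0ℤ)
               ≡ scoeff f (toList u) * (if u ≤ᵥᵇ w then coeff (trunc k n g) (w ∸ᵥ u) else 0ℤ)
    term u with u ≤ᵥᵇ w
    ... | true = sym (cong (scoeff f (toList u) *_) (coeff-trunc-inBox g (w ∸ᵥ u) (inBoxᵇ-∸ᵥ w u w∈box)))
    ... | false = sym (ℤP.*-zeroʳ (scoeff f (toList u)))

-- The inverse limit

-- pad L m cuts m off after L entries; it is only used with length m ≤ L.
pad : (L : ℕ) → List ℕ → Vec ℕ L
pad zero m = []
pad (suc L) [] = 0 ∷ pad L []
pad (suc L) (x ∷ m) = x ∷ pad L m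

pad-suc : ∀ L m → length m ≤ L → pad (suc L) m ≡ pad L m ∷ʳ 0
pad-suc zero [] _ = refl
pad-suc (suc L) [] _ = cong (0 ∷_) (pad-suc L [] z≤n)
pad-suc (suc L) (x ∷ m) (s≤s |m|≤L) = cong (x ∷_) (pad-suc L m |m|≤L)

pad-strip : ∀ L m → pad L (strip m) ≡ pad L m
pad-strip zero m = refl
pad-strip (suc L) [] = refl
pad-strip (suc L) (x ∷ m) = trans (pad-cons0 x (strip m)) (cong (x ∷_) (pad-strip L m))
  where
  pad-cons0 : ∀ a s → pad (suc L) (cons0 a s) ≡ a ∷ pad L s
  pad-cons0 zero [] = refl
  pad-cons0 zero (_ ∷ _) = refl
  pad-cons0 (suc a) s = refl

strip-pad : ∀ L m → length m ≤ L → strip (toList (pad L m)) ≡ strip m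
strip-pad zero [] _ = refl
strip-pad (suc L) [] _ = cong (cons0 0) (strip-pad L [] z≤n)
strip-pad (suc L) (x ∷ m) (s≤s |m|≤L) = cong (cons0 x) (strip-pad L m |m|≤L)

pad-toList : ∀ {n} d (w : Vec ℕ n) → pad (d ℕ.+ n) (toList w) ≡ padZeros d w
pad-toList zero w = pad-self w
  where
  pad-self : ∀ {n} (w : Vec ℕ n) → pad n (toList w) ≡ w
  pad-self [] = refl
  pad-self (x ∷ w) = cong (x ∷_) (pad-self w)
pad-toList {n} (suc d) w =
  trans (pad-suc (d ℕ.+ n) (toList w) (ℕP.≤-trans (ℕP.≤-reflexive (VecP.length-toList w)) (ℕP.m≤n+m n d)))
        (cong (_∷ʳ 0) (pad-toList d w))

vsum-pad : ∀ L m → length m ≤ L → vsum (pad L m) ≡ ListAction.sum m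
vsum-pad zero [] _ = refl
vsum-pad (suc L) [] _ = vsum-pad L [] z≤n
vsum-pad (suc L) (x ∷ m) (s≤s |m|≤L) = cong (x ℕ.+_) (vsum-pad L m |m|≤L)

inBoxᵇ-pad : ∀ {k} → 1 ≤ k → ∀ L {m} → All (_< k) m → inBoxᵇ k (pad L m) ≡ true
inBoxᵇ-pad 1≤k zero _ = refl
inBoxᵇ-pad {suc k} 1≤k (suc L) [] = inBoxᵇ-pad 1≤k L []
inBoxᵇ-pad 1≤k (suc L) (x<k ∷ m<k) rewrite T⇒true (ℕP.<⇒<ᵇ x<k) = inBoxᵇ-pad 1≤k L m<k

All-strip : ∀ {P : ℕ → Set} {m} → All P m → All P (strip m)
All-strip [] = []
All-strip {m = x ∷ _} (px ∷ pm) = cons0-All x px (All-strip pm)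
  where
  cons0-All : ∀ {P : ℕ → Set} a {s} → P a → All P s → All P (cons0 a s)
  cons0-All zero {[]} _ _ = []
  cons0-All zero {_ ∷ _} p ps = p ∷ ps
  cons0-All (suc a) p ps = p ∷ ps

length-strip : ∀ m → length (strip m) ≤ length m
length-strip [] = z≤n
length-strip (x ∷ m) = ℕP.≤-trans (length-cons0 x (strip m)) (s≤s (length-strip m))
  where
  length-cons0 : ∀ a s → length (cons0 a s) ≤ suc (length s)
  length-cons0 zero [] = z≤n
  length-cons0 zero (_ ∷ _) = ℕP.≤-refl
  length-cons0 (suc a) s = ℕP.≤-refl

sum-strip : ∀ m → ListAction.sum (strip m) ≡ ListAction.sum m
sum-strip [] = refl
sum-strip (x ∷ m) = trans (sum-cons0 x (strip m)) (cong (x ℕ.+_) (sum-strip m))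
  where
  sum-cons0 : ∀ a s → ListAction.sum (cons0 a s) ≡ a ℕ.+ ListAction.sum s
  sum-cons0 zero [] = refl
  sum-cons0 zero (_ ∷ _) = refl
  sum-cons0 (suc a) s = refl

vsum-toList : ∀ {n} (w : Vec ℕ n) → ListAction.sum (toList w) ≡ vsum w
vsum-toList [] = refl
vsum-toList (x ∷ w) = cong (x ℕ.+_) (vsum-toList w)

-- Once level k m ≤ L, the monomial m fits into L variables and has degree ≤ L - k, so its
-- coefficient is an invariant of the class in R_{L,k}.
level : ℕ → List ℕ → ℕ
level k m = ListAction.sum m ℕ.+ k ℕ.+ length m

k≤level : ∀ k m → k ≤ level k m
k≤level k m = ℕP.≤-trans (ℕP.m≤n+m k _) (ℕP.m≤m+n _ (length m))

length≤level : ∀ k m → length m ≤ level k m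
length≤level k m = ℕP.m≤n+m (length m) _

degree+k≤level : ∀ k m → ListAction.sum m ℕ.+ k ≤ level k m
degree+k≤level k m = ℕP.m≤m+n _ (length m)

level-strip : ∀ k m → level k (strip m) ≤ level k m
level-strip k m rewrite sum-strip m = ℕP.+-monoʳ-≤ _ (length-strip m)

EqR-refl : ∀ {k n} (p : Poly n) → EqR k n p p
EqR-refl p = EqR-of-box-agreement p p (λ _ _ → refl)

trunc-injective : ∀ {k} → 1 ≤ k → (f g : Series) → (∀ n → k ≤ n → EqR k n (trunc k n f) (trunc k n g)) → f ≈[P k ] g
trunc-injective {k} 1≤k f g f~g m m<k = begin
  scoeff f m                    ≡⟨ cong f (sym (strip-pad L m (length≤level k m))) ⟩
  scoeff f (toList w)           ≡⟨ sym (coeff-trunc-inBox f w w∈box) ⟩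
  coeff (trunc k L f) w         ≡⟨ EqR⇒box-coeff≡ (trunc k L f) (trunc k L g) (f~g L (k≤level k m)) w w∈box degree ⟩
  coeff (trunc k L g) w         ≡⟨ coeff-trunc-inBox g w w∈box ⟩
  scoeff g (toList w)           ≡⟨ cong g (strip-pad L m (length≤level k m)) ⟩
  scoeff g m                    ∎
  where
  open ≡-Reasoning
  L = level k m
  w = pad L m
  w∈box = inBoxᵇ-pad 1≤k L m<k
  degree : vsum w ℕ.+ k ≤ L
  degree rewrite vsum-pad L m (length≤level k m) = degree+k≤level k m

module InverseLimit {k} (1≤k : 1 ≤ k) (a : (n : ℕ) → Poly n)
                    (compat : (n : ℕ) → k ≤ n → EqR k n (proj (a (suc n))) (a n)) where

  coeff-pad-step : ∀ {m} → All (_< k) m → ∀ L → level k m ≤ L → coeff (a L) (pad L m) ≡ coeff (a (suc L)) (pad (suc L) m)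
  coeff-pad-step {m} m<k L lvl≤L = begin
    coeff (a L) (pad L m)               ≡⟨ sym (EqR⇒box-coeff≡ (proj (a (suc L))) (a L) (compat L k≤L) (pad L m) (inBoxᵇ-pad 1≤k L m<k) degree) ⟩
    coeff (proj (a (suc L))) (pad L m)  ≡⟨ coeff-proj (a (suc L)) (pad L m) ⟩
    coeff (a (suc L)) (pad L m ∷ʳ 0)    ≡⟨ cong (coeff (a (suc L))) (sym (pad-suc L m (ℕP.≤-trans (length≤level k m) lvl≤L))) ⟩
    coeff (a (suc L)) (pad (suc L) m)   ∎
    where
    open ≡-Reasoning
    k≤L = ℕP.≤-trans (k≤level k m) lvl≤L
    degree : vsum (pad L m) ℕ.+ k ≤ L
    degree rewrite vsum-pad L m (ℕP.≤-trans (length≤level k m) lvl≤L) = ℕP.≤-trans (degree+k≤level k m) lvl≤L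

  coeff-pad-stable : ∀ {m} → All (_< k) m → ∀ {L M} → level k m ≤ L → L ≤ M → coeff (a L) (pad L m) ≡ coeff (a M) (pad M m)
  coeff-pad-stable {m} m<k {L} lvl≤L L≤M = go (ℕP.≤⇒≤′ L≤M)
    where
    go : ∀ {M} → L ℕ.≤′ M → coeff (a L) (pad L m) ≡ coeff (a M) (pad M m)
    go ℕ.≤′-refl = refl
    go (ℕ.≤′-step L≤′M) = trans (go L≤′M) (coeff-pad-step m<k _ (ℕP.≤-trans lvl≤L (ℕP.≤′⇒≤ L≤′M)))

  limit : Series
  limit m = coeff (a (level k m)) (pad (level k m) m)

  scoeff-limit : ∀ {m} → All (_< k) m → ∀ {L} → level k m ≤ L → scoeff limit m ≡ coeff (a L) (pad L m)
  scoeff-limit {m} m<k {L} lvl≤L =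
    trans (coeff-pad-stable (All-strip m<k) ℕP.≤-refl (ℕP.≤-trans (level-strip k m) lvl≤L)) (cong (coeff (a L)) (pad-strip L m))

  projs-a~a : ∀ n → k ≤ n → ∀ d → EqR k n (projs d (a (d ℕ.+ n))) (a n)
  projs-a~a n k≤n zero = EqR-refl (a n)
  projs-a~a n k≤n (suc d) = EqR-trans (projs d (proj (a (suc d ℕ.+ n)))) (projs d (a (d ℕ.+ n))) (a n)
    (projs-EqR 1≤k d (proj (a (suc d ℕ.+ n))) (a (d ℕ.+ n)) (compat (d ℕ.+ n) (ℕP.≤-trans k≤n (ℕP.m≤n+m n d))))
    (projs-a~a n k≤n d)

  trunc-limit : ∀ n → k ≤ n → EqR k n (trunc k n limit) (a n)
  trunc-limit n k≤n = EqR-trans (trunc k n limit) (projs d (a (d ℕ.+ n))) (a n)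
      (EqR-of-box-agreement (trunc k n limit) (projs d (a (d ℕ.+ n))) box-coeff) (projs-a~a n k≤n d)
    where
    -- a box monomial in n variables has degree ≤ n (k - 1), hence level ≤ d + n
    d = n ℕ.* ℕ.pred k ℕ.+ k
    box-coeff : ∀ w → inBoxᵇ k w ≡ true → coeff (trunc k n limit) w ≡ coeff (projs d (a (d ℕ.+ n))) w
    box-coeff w w∈box = begin
      coeff (trunc k n limit) w                    ≡⟨ coeff-trunc-inBox limit w w∈box ⟩
      scoeff limit (toList w)                      ≡⟨ scoeff-limit (inBoxᵇ⇒All w w∈box) level≤ ⟩
      coeff (a (d ℕ.+ n)) (pad (d ℕ.+ n) (toList w)) ≡⟨ cong (coeff (a (d ℕ.+ n))) (pad-toList d w) ⟩
      coeff (a (d ℕ.+ n)) (padZeros d w)           ≡⟨ sym (coeff-projs d (a (d ℕ.+ n)) w) ⟩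
      coeff (projs d (a (d ℕ.+ n))) w              ∎
      where
      open ≡-Reasoning
      level≤ : level k (toList w) ≤ d ℕ.+ n
      level≤ rewrite vsum-toList w | VecP.length-toList w =
        ℕP.+-monoˡ-≤ n (ℕP.+-monoˡ-≤ k (vsum-inBoxᵇ k w w∈box))

proposition7p3 : (k : ℕ) → 1 ≤ k →
    -- the maps P → R_{n,k} are well defined on P
    ((f g : Series) → f ≈[P k ] g → (n : ℕ) → k ≤ n → EqR k n (trunc k n f) (trunc k n g))
  × -- they are ring homomorphisms
    ((n : ℕ) → k ≤ n → (f g : Series) →
        EqR k n (trunc k n (f +S g)) (trunc k n f +P trunc k n g)
      × EqR k n (trunc k n (f *S g)) (trunc k n f *P trunc k n g)
      × EqR k n (trunc k n 1S) 1P)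
  × -- they are compatible with the inverse system R_{n+1,k} ↠ R_{n,k}
    ((f : Series) → (n : ℕ) → k ≤ n → EqR k n (proj (trunc k (suc n) f)) (trunc k n f))
  × -- existence: every compatible family comes from an element of P
    ((a : (n : ℕ) → Poly n) →
      ((n : ℕ) → k ≤ n → EqR k n (proj (a (suc n))) (a n)) →
      Σ Series (λ f → (n : ℕ) → k ≤ n → EqR k n (trunc k n f) (a n)))
  × -- uniqueness: an element of P is determined by its images
    ((f g : Series) → ((n : ℕ) → k ≤ n → EqR k n (trunc k n f) (trunc k n g)) → f ≈[P k ] g)
proposition7p3 k 1≤k =
    (λ f g f≈g n _ → trunc-resp-≈ n f g f≈g)
  , (λ n _ f g → trunc-+S k n f g , trunc-*S k n f g , trunc-1S k n)
  , (λ f n _ → proj-trunc k 1≤k n f)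
  , (λ a compat → InverseLimit.limit 1≤k a compat , InverseLimit.trunc-limit 1≤k a compat)
  , trunc-injective 1≤k
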